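{- Let $\pi\in\mathcal B(n)$ and let $p_{n,\alpha}$ be its bounce path. Then $\alpha$ is a strict partition (its parts are strictly decreasing) and $\mathbf a(\pi)\le\mathbf a(p_{n,\alpha})+\min\{\alpha_i-\alpha_{i+1}-1:1\le i<\ell(\alpha)\}$ (the minimum over an empty set being $+\infty$).
   Context: A Dyck path of semilength $n$ is a lattice path from $(0,0)$ to $(n,n)$ with unit north steps $\mathsf N$ and east steps $\mathsf E$ never going below $y=x$; $\mathcal D(n)$ is their set. The area $\mathbf a(\pi)$ is the number of whole unit cells between $\pi$ and the diagonal. With $h_i$ the $y$-coordinate of the east step of $\pi$ in column $i$ (strip $i-1\le x\le i$), the bounce points are $b_0=0$, $b_k=h_{b_{k-1}+1}$ until $b_m=n$; the bounce composition is $\alpha=(\alpha_1,\dots,\alpha_m)$, $\alpha_k=b_k-b_{k-1}$, $\ell(\alpha)=m$; the bounce path is $p_{n,\alpha}=\mathsf N^{\alpha_1}\mathsf E^{\alpha_1}\cdots\mathsf N^{\alpha_m}\mathsf E^{\alpha_m}$; the bounce is $\mathbf b(\pi)=\sum_{k=1}^m(n-b_k)$. $\mathcal B(n)$ is the set of $\pi\in\mathcal D(n)$ such that $\mathbf b(\tau)\ge\mathbf b(\pi)$ for every $\tau\in\mathcal D(n)$ with $\mathbf a(\tau)+\mathbf b(\tau)=\mathbf a(\pi)+\mathbf b(\pi)$. -}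

module Defs where

open import Data.Nat using (ℕ; zero; suc; _+_; _∸_; _≤_; _<?_)
open import Data.List using (List; []; _∷_; _++_; length; replicate)
open import Data.Nat.ListAction using (sum)
open import Data.Empty using (⊥)
open import Data.Unit using (⊤)
open import Data.Product using (_×_)
open import Relation.Nullary using (yes; no)
open import Relation.Binary.PropositionalEquality using (_≡_)

-- Lattice steps: N = unit north step, E = unit east step.
data Step : Set where
  N E : Step

Path : Set
Path = List Step

-- Never-below-diagonal check, tracking the current height above the diagonal
-- (#N − #E so far); must end on the diagonal.
Above : ℕ → Path → Set
Above h       []      = h ≡ 0
Above h       (N ∷ s) = Above (suc h) s
Above zero    (E ∷ s) = ⊥
Above (suc h) (E ∷ s) = Above h s

IsDyck : ℕ → Path → Set
IsDyck n π = (length π ≡ n + n) × Above 0 π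

-- y-coordinates of the east steps, in order: [h₁, h₂, …, hₙ]
-- (starting at current y-coordinate y).
eastHeights : ℕ → Path → List ℕ
eastHeights y []      = []
eastHeights y (N ∷ s) = eastHeights (suc y) s
eastHeights y (E ∷ s) = y ∷ eastHeights y s

areaFrom : ℕ → List ℕ → ℕ
areaFrom i []       = 0
areaFrom i (h ∷ hs) = (h ∸ i) + areaFrom (suc i) hs

-- area a(π): number of whole unit cells between π and the diagonal;
-- column i (strip i−1 ≤ x ≤ i) contributes h_i − i cells.
area : Path → ℕ
area π = areaFrom 1 (eastHeights 0 π)

-- 1-based lookup with default 0:  nth hs i = h_i.
nth : List ℕ → ℕ → ℕ
nth []       _             = 0
nth (h ∷ hs) zero          = 0
nth (h ∷ hs) (suc zero)    = h
nth (h ∷ hs) (suc (suc i)) = nth hs (suc i)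

-- bounce points b₁, …, b_m starting after b (with fuel; fuel n suffices for
-- Dyck paths since b_k > b_{k-1}):  b_k = h_{b_{k-1}+1} until b_m = n.
bouncePtsFrom : ℕ → List ℕ → ℕ → ℕ → List ℕ
bouncePtsFrom zero       hs n b = []
bouncePtsFrom (suc fuel) hs n b with b <? n
... | yes _ = let b' = nth hs (suc b) in b' ∷ bouncePtsFrom fuel hs n b'
... | no  _ = []

-- [b₁, …, b_m]  (b₀ = 0 omitted)
bouncePoints : ℕ → Path → List ℕ
bouncePoints n π = bouncePtsFrom n (eastHeights 0 π) n 0

diffsFrom : ℕ → List ℕ → List ℕ
diffsFrom p []       = []
diffsFrom p (b ∷ bs) = (b ∸ p) ∷ diffsFrom b bs

bounceComp : ℕ → Path → List ℕ
bounceComp n π = diffsFrom 0 (bouncePoints n π)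

bounce : ℕ → Path → ℕ
bounce n π = sum (Data.List.map (λ b → n ∸ b) (bouncePoints n π))

bouncePath : List ℕ → Path
bouncePath []      = []
bouncePath (a ∷ α) = replicate a N ++ replicate a E ++ bouncePath α

InB : ℕ → Path → Set
InB n π = IsDyck n π ×
  ((τ : Path) → IsDyck n τ →
     area τ + bounce n τ ≡ area π + bounce n π → bounce n π ≤ bounce n τ)

module Submission where

-- Describe a Dyck path by its column heights and let p < c < c′ be consecutive bounce
-- points.  Raising the columns p + 1, …, c to height c + 1 moves the bounce point c to
-- c + 1 (absorbing it into c′ = c + 1 = n in the last step), so the bounce drops by
-- exactly one while the area grows.  Between a height function and the bounce path of
-- its own bounce points, single columns can be lowered one cell at a time without
-- changing the bounce points, so every intermediate area is attained.  If the claimed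
-- inequality failed at (p, c, c′), the bounce path of the new bounce points would have
-- area at most a(π) + 1, giving τ with a(τ) = a(π) + 1 and b(τ) = b(π) − 1, against
-- π ∈ ℬ(n).  The raised path has these bounce points only when h_{c+2} = c′; otherwise
-- π has at least c′ − c − 1 cells more than its bounce path in columns c + 2, …, c′,
-- which contradicts the inequality for the next pair, proved first.  Strictness of α
-- follows because the bounce path lies below π.

open import Defs
open import Data.Nat
  using (ℕ; zero; suc; pred; _+_; _∸_; _≤_; _<_; _>_; _⊔_; z≤n; s≤s; z<s; s<s; _<?_; _≤?_; >-nonZero)
open import Data.Nat.Properties
open import Data.Nat.ListAction using (sum)
open import Data.Nat.ListAction.Properties using (sum-++)
open import Data.List using (List; []; _∷_; _++_; length; replicate; map; applyUpTo)
open import Data.List.Properties using (length-applyUpTo; length-replicate; map-++; ++-assoc)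
open import Data.List.Relation.Unary.Linked as Linked using (Linked; []; [-]; _∷_)
open import Data.Product using (∃-syntax; _×_; _,_; proj₁; proj₂)
open import Data.Sum using (_⊎_; inj₁; inj₂)
open import Data.Empty using (⊥; ⊥-elim)
open import Function using (_∘_)
open import Data.Nat.Tactic.RingSolver using (solve-∀)
open import Relation.Nullary using (yes; no; contradiction)
open import Relation.Binary.Definitions using (tri<; tri≈; tri>)
open import Relation.Binary.PropositionalEquality
  using (_≡_; refl; sym; trans; cong; cong₂; subst; subst₂; module ≡-Reasoning)

∑ : ℕ → (ℕ → ℕ) → ℕ
∑ zero    f = 0
∑ (suc n) f = f 0 + ∑ n (f ∘ suc)

infix 4 _≤[_]_

_≤[_]_ : (ℕ → ℕ) → ℕ → (ℕ → ℕ) → Set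
f ≤[ n ] g = ∀ i → i < n → f i ≤ g i

≤[suc] : ∀ {m f g} → f 0 ≤ g 0 → (f ∘ suc) ≤[ m ] (g ∘ suc) → f ≤[ suc m ] g
≤[suc] le₀ le zero    _         = le₀
≤[suc] le₀ le (suc i) (s<s i<m) = le i i<m

∑-cong : ∀ n {f g} → (∀ i → i < n → f i ≡ g i) → ∑ n f ≡ ∑ n g
∑-cong zero    eq = refl
∑-cong (suc n) eq = cong₂ _+_ (eq 0 z<s) (∑-cong n (λ i i<n → eq (suc i) (s<s i<n)))

∑-mono-≤ : ∀ n {f g} → f ≤[ n ] g → ∑ n f ≤ ∑ n g
∑-mono-≤ zero    f≤g = z≤n
∑-mono-≤ (suc n) f≤g = +-mono-≤ (f≤g 0 z<s) (∑-mono-≤ n (λ i i<n → f≤g (suc i) (s<s i<n)))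

∑-mono-gap : ∀ n {f g} l r → f ≤[ n ] g → (∀ {i} → l ≤ i → i < r → f i < g i) → r ≤ n →
             ∑ n f + (r ∸ l) ≤ ∑ n g
∑-mono-gap n {f} l zero f≤g _ _ = begin
  ∑ n f + (0 ∸ l) ≡⟨ cong (∑ n f +_) (0∸n≡0 l) ⟩
  ∑ n f + 0       ≡⟨ +-identityʳ (∑ n f) ⟩
  ∑ n f           ≤⟨ ∑-mono-≤ n f≤g ⟩
  _               ∎
  where open ≤-Reasoning
∑-mono-gap (suc n) {f} zero (suc r) f≤g gap (s≤s r≤n) = begin
  (f 0 + ∑ n (f ∘ suc)) + suc r   ≡⟨ +-assoc (f 0) _ (suc r) ⟩
  f 0 + (∑ n (f ∘ suc) + suc r)   ≡⟨ cong (f 0 +_) (+-suc (∑ n (f ∘ suc)) r) ⟩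
  f 0 + suc (∑ n (f ∘ suc) + r)   ≡⟨ +-suc (f 0) _ ⟩
  suc (f 0) + (∑ n (f ∘ suc) + r) ≤⟨ +-mono-≤ (gap z≤n z<s)
                                       (∑-mono-gap n zero r (λ i i<n → f≤g (suc i) (s<s i<n))
                                         (λ _ i<r → gap z≤n (s<s i<r)) r≤n) ⟩
  _                               ∎
  where open ≤-Reasoning
∑-mono-gap (suc n) {f} (suc l) (suc r) f≤g gap (s≤s r≤n) = begin
  (f 0 + ∑ n (f ∘ suc)) + (r ∸ l) ≡⟨ +-assoc (f 0) _ (r ∸ l) ⟩
  f 0 + (∑ n (f ∘ suc) + (r ∸ l)) ≤⟨ +-mono-≤ (f≤g 0 z<s)
                                       (∑-mono-gap n l r (λ i i<n → f≤g (suc i) (s<s i<n))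
                                         (λ l≤i i<r → gap (s≤s l≤i) (s<s i<r)) r≤n) ⟩
  _                               ∎
  where open ≤-Reasoning

∑-mono-< : ∀ n {f g k} → f ≤[ n ] g → k < n → f k < g k → ∑ n f < ∑ n g
∑-mono-< n {f} {g} {k} f≤g k<n fk<gk = begin
  suc (∑ n f)          ≡˘⟨ +-comm (∑ n f) 1 ⟩
  ∑ n f + 1            ≡˘⟨ cong (∑ n f +_) (m+n∸n≡m 1 k) ⟩
  ∑ n f + (suc k ∸ k)  ≤⟨ ∑-mono-gap n k (suc k) f≤g only-k k<n ⟩
  ∑ n g                ∎
  where
  open ≤-Reasoning
  only-k : ∀ {i} → k ≤ i → i < suc k → f i < g i
  only-k k≤i (s≤s i≤k) rewrite ≤-antisym i≤k k≤i = fk<gk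

∑-split : ∀ m n f → ∑ (m + n) f ≡ ∑ m f + ∑ n (λ j → f (m + j))
∑-split zero    n f = refl
∑-split (suc m) n f = trans (cong (f 0 +_) (∑-split m n (f ∘ suc))) (sym (+-assoc (f 0) _ _))

∑-∸ : ∀ n {f g} → g ≤[ n ] f → ∑ n (λ i → f i ∸ g i) + ∑ n g ≡ ∑ n f
∑-∸ zero    g≤f = refl
∑-∸ (suc n) {f} {g} g≤f = begin
  (f 0 ∸ g 0 + D) + (g 0 + G) ≡⟨ interchange (f 0 ∸ g 0) D (g 0) G ⟩
  (f 0 ∸ g 0 + g 0) + (D + G) ≡⟨ cong₂ _+_ (m∸n+n≡m (g≤f 0 z<s))
                                           (∑-∸ n (λ i i<n → g≤f (suc i) (s<s i<n))) ⟩
  f 0 + ∑ n (f ∘ suc)         ∎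
  where
  open ≡-Reasoning
  D = ∑ n (λ i → f (suc i) ∸ g (suc i))
  G = ∑ n (g ∘ suc)
  interchange : ∀ w x y z → (w + x) + (y + z) ≡ (w + y) + (x + z)
  interchange = solve-∀

-- Lowering a monotone function between two bounds

Monotone : ℕ → (ℕ → ℕ) → Set
Monotone n F = ∀ {i k} → i ≤ k → k < n → F i ≤ F k

monotone-suc : ∀ {m F} → Monotone (suc m) F → Monotone m (F ∘ suc)
monotone-suc mF i≤k k<m = mF (s≤s i≤k) (s<s k<m)

_◂_ : ℕ → (ℕ → ℕ) → ℕ → ℕ
(x ◂ f) zero    = x
(x ◂ f) (suc i) = f i

monotone-◂ : ∀ {m x f} → Monotone m f → (∀ {k} → k < m → x ≤ f k) → Monotone (suc m) (x ◂ f)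
monotone-◂ mf x≤f {zero}  {zero}  _          _         = ≤-refl
monotone-◂ mf x≤f {zero}  {suc k} _          (s<s k<m) = x≤f k<m
monotone-◂ mf x≤f {suc i} {suc k} (s≤s i≤k) (s<s k<m) = mf i≤k k<m

Squeezed : ℕ → (ℕ → ℕ) → (ℕ → ℕ) → (ℕ → ℕ) → Set
Squeezed n G F F′ = Monotone n F′ × G ≤[ n ] F′ × F′ ≤[ n ] F

lower-step : ∀ n {G F} → Monotone n G → Monotone n F → G ≤[ n ] F → ∑ n G < ∑ n F →
             ∃[ F′ ] Squeezed n G F F′ × ∑ n F ≡ suc (∑ n F′)
lower-step zero    _  _  _   ()
lower-step (suc n) {G} {F} mG mF G≤F ∑G<∑F with G 0 <? F 0
... | yes G₀<F₀ =
  pred (F 0) ◂ (F ∘ suc)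
  , (monotone-◂ (monotone-suc mF) (λ k<n → ≤-trans pred[n]≤n (mF z≤n (s<s k<n)))
  , ≤[suc] (<⇒≤pred G₀<F₀) (λ i i<n → G≤F (suc i) (s<s i<n))
  , ≤[suc] pred[n]≤n (λ _ _ → ≤-refl))
  , cong (_+ ∑ n (F ∘ suc)) (sym (suc-pred (F 0) {{>-nonZero (<-≤-trans z<s G₀<F₀)}}))
... | no G₀≮F₀ =
  extend (lower-step n (monotone-suc mG) (monotone-suc mF) (λ i i<n → G≤F (suc i) (s<s i<n)) tail<)
  where
  F₀≡G₀ : F 0 ≡ G 0
  F₀≡G₀ = ≤-antisym (≮⇒≥ G₀≮F₀) (G≤F 0 z<s)
  tail< : ∑ n (G ∘ suc) < ∑ n (F ∘ suc)
  tail< = +-cancelˡ-< (G 0) _ _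
            (subst (λ x → G 0 + ∑ n (G ∘ suc) < x + ∑ n (F ∘ suc)) F₀≡G₀ ∑G<∑F)
  extend : ∃[ F″ ] Squeezed n (G ∘ suc) (F ∘ suc) F″ × ∑ n (F ∘ suc) ≡ suc (∑ n F″) →
           ∃[ F′ ] Squeezed (suc n) G F F′ × ∑ (suc n) F ≡ suc (∑ (suc n) F′)
  extend (F″ , (mF″ , G≤F″ , F″≤F) , ∑F≡) =
    F 0 ◂ F″
    , (monotone-◂ mF″ (λ k<n → ≤-trans (≤-reflexive F₀≡G₀)
                                        (≤-trans (mG z≤n (s<s k<n)) (G≤F″ _ k<n)))
    , ≤[suc] (G≤F 0 z<s) G≤F″
    , ≤[suc] ≤-refl F″≤F)
    , trans (cong (F 0 +_) ∑F≡) (+-suc (F 0) _)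

lower-to : ∀ n {G F} T → Monotone n G → Monotone n F → G ≤[ n ] F → ∑ n G ≤ T → T ≤ ∑ n F →
           ∃[ F′ ] Squeezed n G F F′ × ∑ n F′ ≡ T
lower-to n {G} {F} T mG mF G≤F ∑G≤T T≤∑F = lower-by (∑ n F ∸ T) mF G≤F (sym (m∸n+n≡m T≤∑F))
  where
  lower-by : ∀ d {F} → Monotone n F → G ≤[ n ] F → ∑ n F ≡ d + T →
             ∃[ F′ ] Squeezed n G F F′ × ∑ n F′ ≡ T
  lower-by zero    {F} mF G≤F ∑F≡T = F , (mF , G≤F , λ _ _ → ≤-refl) , ∑F≡T
  lower-by (suc d) {F} mF G≤F ∑F≡
    with lower-step n mG mF G≤F (≤-<-trans ∑G≤T (subst (T <_) (sym ∑F≡) (m<n+m T z<s)))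
  ... | F₁ , (mF₁ , G≤F₁ , F₁≤F) , ∑F≡suc∑F₁
    with lower-by d mF₁ G≤F₁ (suc-injective (trans (sym ∑F≡suc∑F₁) ∑F≡))
  ...   | F′ , (mF′ , G≤F′ , F′≤F₁) , ∑F′≡T =
    F′ , (mF′ , G≤F′ , λ i i<n → ≤-trans (F′≤F₁ i i<n) (F₁≤F i i<n)) , ∑F′≡T

-- Column heights of Dyck paths

-- H i is the height of column i + 1: columns are indexed from 0 throughout, so that
-- the bounce from the point b goes to H b.
record IsHeights (n : ℕ) (H : ℕ → ℕ) : Set where
  field
    above-diagonal : suc ≤[ n ] H
    bounded        : ∀ i → i < n → H i ≤ n
    monotone       : Monotone n H

heightsArea : ℕ → (ℕ → ℕ) → ℕ
heightsArea n H = ∑ n (λ i → H i ∸ suc i)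

lower-area : ∀ {n G F} T → IsHeights n G → IsHeights n F → G ≤[ n ] F →
             heightsArea n G ≤ T → T ≤ heightsArea n F →
             ∃[ F′ ] IsHeights n F′ × G ≤[ n ] F′ × F′ ≤[ n ] F × heightsArea n F′ ≡ T
-- Area and sum of heights differ by the constant ∑ n suc.
lower-area {n} {G} {F} T hG hF G≤F lo hi
  with lower-to n (T + ∑ n suc) (IsHeights.monotone hG) (IsHeights.monotone hF) G≤F
         (subst (_≤ T + ∑ n suc) (∑-∸ n (IsHeights.above-diagonal hG)) (+-monoˡ-≤ _ lo))
         (subst (T + ∑ n suc ≤_) (∑-∸ n (IsHeights.above-diagonal hF)) (+-monoˡ-≤ _ hi))
... | F′ , (mF′ , G≤F′ , F′≤F) , ∑F′≡ =
  F′ , hF′ , G≤F′ , F′≤F , +-cancelʳ-≡ _ _ _ (trans (∑-∸ n (IsHeights.above-diagonal hF′)) ∑F′≡)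
  where
  hF′ : IsHeights n F′
  hF′ = record
    { above-diagonal = λ i i<n → ≤-trans (IsHeights.above-diagonal hG i i<n) (G≤F′ i i<n)
    ; bounded        = λ i i<n → ≤-trans (F′≤F i i<n) (IsHeights.bounded hF i i<n)
    ; monotone       = mF′
    }

height : Path → ℕ → ℕ
height π i = nth (eastHeights 0 π) (suc i)

#N #E : Path → ℕ
#N []      = 0
#N (N ∷ s) = suc (#N s)
#N (E ∷ s) = #N s
#E []      = 0
#E (N ∷ s) = #E s
#E (E ∷ s) = suc (#E s)

length≡#N+#E : ∀ s → length s ≡ #N s + #E s
length≡#N+#E []      = refl
length≡#N+#E (N ∷ s) = cong suc (length≡#N+#E s)
length≡#N+#E (E ∷ s) = trans (cong suc (length≡#N+#E s)) (sym (+-suc (#N s) (#E s)))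

Above⇒#N : ∀ {h} s → Above h s → h + #N s ≡ #E s
Above⇒#N {h}     []      h≡0 = trans (+-identityʳ h) h≡0
Above⇒#N {h}     (N ∷ s) a   = trans (+-suc h (#N s)) (Above⇒#N s a)
Above⇒#N {suc h} (E ∷ s) a   = cong suc (Above⇒#N s a)

Above⇒length : ∀ s → Above 0 s → length s ≡ #E s + #E s
Above⇒length s a = trans (length≡#N+#E s) (cong (_+ #E s) (Above⇒#N s a))

length-eastHeights : ∀ y s → length (eastHeights y s) ≡ #E s
length-eastHeights y []      = refl
length-eastHeights y (N ∷ s) = length-eastHeights (suc y) s
length-eastHeights y (E ∷ s) = cong suc (length-eastHeights y s)

eastHeights-≥ : ∀ y s i → i < length (eastHeights y s) → y ≤ nth (eastHeights y s) (suc i)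
eastHeights-≥ y (N ∷ s) i       i<ℓ       = <⇒≤ (eastHeights-≥ (suc y) s i i<ℓ)
eastHeights-≥ y (E ∷ s) zero    _         = ≤-refl
eastHeights-≥ y (E ∷ s) (suc i) (s<s i<ℓ) = eastHeights-≥ y s i i<ℓ

eastHeights-≤ : ∀ y s i → i < length (eastHeights y s) → nth (eastHeights y s) (suc i) ≤ y + #N s
eastHeights-≤ y (N ∷ s) i       i<ℓ       =
  ≤-trans (eastHeights-≤ (suc y) s i i<ℓ) (≤-reflexive (sym (+-suc y (#N s))))
eastHeights-≤ y (E ∷ s) zero    _         = m≤m+n y (#N s)
eastHeights-≤ y (E ∷ s) (suc i) (s<s i<ℓ) = eastHeights-≤ y s i i<ℓ

eastHeights-monotone : ∀ y s → Monotone (length (eastHeights y s)) (λ i → nth (eastHeights y s) (suc i))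
eastHeights-monotone y (N ∷ s)                                       = eastHeights-monotone (suc y) s
eastHeights-monotone y (E ∷ s) {zero}  {zero}  _          _         = ≤-refl
eastHeights-monotone y (E ∷ s) {zero}  {suc k} _          (s<s k<ℓ) = eastHeights-≥ y s k k<ℓ
eastHeights-monotone y (E ∷ s) {suc i} {suc k} (s≤s i≤k) (s<s k<ℓ) = eastHeights-monotone y s i≤k k<ℓ

-- The path s starts at the point (x, y), h = y − x above the diagonal.
eastHeights-above : ∀ {x y h} s → Above h s → y ≡ x + h →
                    ∀ i → i < length (eastHeights y s) → x + i < nth (eastHeights y s) (suc i)
eastHeights-above {x} {y} {h} (N ∷ s) a y≡ i i<ℓ =
  eastHeights-above s a (trans (cong suc y≡) (sym (+-suc x h))) i i<ℓ
eastHeights-above {x} {y} {suc h} (E ∷ s) a y≡ zero _ =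
  subst₂ _<_ (sym (+-identityʳ x)) (sym y≡) (m<m+n x z<s)
eastHeights-above {x} {y} {suc h} (E ∷ s) a y≡ (suc i) (s<s i<ℓ) =
  subst (_< nth (eastHeights y s) (suc i)) (sym (+-suc x i))
    (eastHeights-above s a (trans y≡ (+-suc x h)) i i<ℓ)

m+m≡n+n⇒m≡n : ∀ {m n} → m + m ≡ n + n → m ≡ n
m+m≡n+n⇒m≡n {m} {n} eq with <-cmp m n
... | tri< m<n _ _ = contradiction eq (<⇒≢ (+-mono-< m<n m<n))
... | tri≈ _ m≡n _ = m≡n
... | tri> _ _ n<m = contradiction (sym eq) (<⇒≢ (+-mono-< n<m n<m))

module _ {n : ℕ} (π : Path) (dyck : IsDyck n π) where

  dyck-#E : #E π ≡ n
  dyck-#E = m+m≡n+n⇒m≡n (trans (sym (Above⇒length π (proj₂ dyck))) (proj₁ dyck))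

  dyck-#N : #N π ≡ n
  dyck-#N = trans (Above⇒#N π (proj₂ dyck)) dyck-#E

  dyck-length : length (eastHeights 0 π) ≡ n
  dyck-length = trans (length-eastHeights 0 π) dyck-#E

  dyck-isHeights : IsHeights n (height π)
  dyck-isHeights = record
    { above-diagonal = λ i i<n → eastHeights-above π (proj₂ dyck) refl i (in-range i<n)
    ; bounded        = λ i i<n → subst (height π i ≤_) dyck-#N (eastHeights-≤ 0 π i (in-range i<n))
    ; monotone       = λ i≤k k<n → eastHeights-monotone 0 π i≤k (in-range k<n)
    }
    where
    in-range : ∀ {i} → i < n → i < length (eastHeights 0 π)
    in-range = subst (_ <_) (sym dyck-length)

areaFrom-∑ : ∀ s es → areaFrom s es ≡ ∑ (length es) (λ i → nth es (suc i) ∸ (s + i))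
areaFrom-∑ s []       = refl
areaFrom-∑ s (e ∷ es) =
  cong₂ _+_ (cong (e ∸_) (sym (+-identityʳ s)))
    (trans (areaFrom-∑ (suc s) es)
           (∑-cong (length es) (λ i _ → cong (nth es (suc i) ∸_) (sym (+-suc s i)))))

dyck-area : ∀ {n} π → IsDyck n π → area π ≡ heightsArea n (height π)
dyck-area {n} π dyck =
  trans (areaFrom-∑ 1 (eastHeights 0 π))
        (cong (λ ℓ → heightsArea ℓ (height π)) (dyck-length {n} π dyck))

∸-telescope : ∀ {a b c} → a ≤ b → b ≤ c → (c ∸ b) + (b ∸ a) ≡ c ∸ a
∸-telescope {a} {b} {c} a≤b b≤c = trans (sym (+-∸-assoc (c ∸ b) a≤b)) (cong (_∸ a) (m∸n+n≡m b≤c))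

suc[m∸1+n]≡m∸n : ∀ {m n} → n < m → suc (m ∸ suc n) ≡ m ∸ n
suc[m∸1+n]≡m∸n {suc m} (s≤s n≤m) = sym (+-∸-assoc 1 n≤m)

staircase : ℕ → (ℕ → ℕ) → Path
staircase zero    G = []
staircase (suc m) G = replicate (G 1 ∸ G 0) N ++ E ∷ staircase m (G ∘ suc)

eastHeights-N* : ∀ k y s → eastHeights y (replicate k N ++ s) ≡ eastHeights (k + y) s
eastHeights-N* zero    y s = refl
eastHeights-N* (suc k) y s =
  trans (eastHeights-N* k (suc y) s) (cong (λ z → eastHeights z s) (+-suc k y))

Above-N* : ∀ k {h} s → Above (k + h) s → Above h (replicate k N ++ s)
Above-N* zero        s a = a
Above-N* (suc k) {h} s a = Above-N* k s (subst (λ z → Above z s) (sym (+-suc k h)) a)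

eastHeights-staircase : ∀ m {G} → Monotone (suc m) G →
                        eastHeights (G 0) (staircase m G) ≡ applyUpTo (G ∘ suc) m
eastHeights-staircase zero    _ = refl
eastHeights-staircase (suc m) {G} mG = begin
  eastHeights (G 0) (replicate (G 1 ∸ G 0) N ++ E ∷ rest)
    ≡⟨ eastHeights-N* (G 1 ∸ G 0) (G 0) (E ∷ rest) ⟩
  eastHeights (G 1 ∸ G 0 + G 0) (E ∷ rest)
    ≡⟨ cong (λ y → eastHeights y (E ∷ rest)) (m∸n+n≡m (mG z≤n (s<s z<s))) ⟩
  G 1 ∷ eastHeights (G 1) rest
    ≡⟨ cong (G 1 ∷_) (eastHeights-staircase m (monotone-suc mG)) ⟩
  applyUpTo (G ∘ suc) (suc m)
    ∎
  where
  open ≡-Reasoning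
  rest = staircase m (G ∘ suc)

-- The staircase starts at the point (x, G 0).
staircase-Above : ∀ m {x G} → x ≤ G 0 → Monotone (suc m) G →
                  (∀ i → i < m → x + i < G (suc i)) → (∀ i → i ≤ m → G i ≤ x + m) →
                  Above (G 0 ∸ x) (staircase m G)
staircase-Above zero    {x} {G} x≤G₀ _  _     bnd =
  m≤n⇒m∸n≡0 (subst (G 0 ≤_) (+-identityʳ x) (bnd 0 z≤n))
staircase-Above (suc m) {x} {G} x≤G₀ mG above bnd =
  Above-N* (G 1 ∸ G 0) (E ∷ staircase m (G ∘ suc))
    (subst (λ h → Above h (E ∷ staircase m (G ∘ suc))) heights≡
      (staircase-Above m x<G₁ (monotone-suc mG) above′ bnd′))
  where
  x<G₁ : x < G 1
  x<G₁ = subst (_< G 1) (+-identityʳ x) (above 0 z<s)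
  heights≡ : suc (G 1 ∸ suc x) ≡ (G 1 ∸ G 0) + (G 0 ∸ x)
  heights≡ = trans (suc[m∸1+n]≡m∸n x<G₁) (sym (∸-telescope x≤G₀ (mG z≤n (s<s z<s))))
  above′ : ∀ i → i < m → suc x + i < G (suc (suc i))
  above′ i i<m = subst (_< G (suc (suc i))) (+-suc x i) (above (suc i) (s<s i<m))
  bnd′ : ∀ i → i ≤ m → G (suc i) ≤ suc x + m
  bnd′ i i≤m = subst (G (suc i) ≤_) (+-suc x m) (bnd (suc i) (s≤s i≤m))

nth-applyUpTo : ∀ {f} m i → i < m → nth (applyUpTo f m) (suc i) ≡ f i
nth-applyUpTo (suc m) zero    _         = refl
nth-applyUpTo (suc m) (suc i) (s<s i<m) = nth-applyUpTo m i i<m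

realize : ∀ {n F} → IsHeights n F → ∃[ τ ] IsDyck n τ × (∀ i → i < n → height τ i ≡ F i)
realize {n} {F} hF = τ , (length≡ , above) , heights
  where
  open IsHeights hF
  τ = staircase n (0 ◂ F)
  mono : Monotone (suc n) (0 ◂ F)
  mono = monotone-◂ monotone (λ _ → z≤n)
  bnd : ∀ i → i ≤ n → (0 ◂ F) i ≤ n
  bnd zero    _   = z≤n
  bnd (suc i) i<n = bounded i i<n
  above : Above 0 τ
  above = staircase-Above n z≤n mono above-diagonal bnd
  eh : eastHeights 0 τ ≡ applyUpTo F n
  eh = eastHeights-staircase n mono
  #E≡n : #E τ ≡ n
  #E≡n = trans (sym (length-eastHeights 0 τ)) (trans (cong length eh) (length-applyUpTo F n))
  length≡ : length τ ≡ n + n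
  length≡ = trans (Above⇒length τ above) (cong₂ _+_ #E≡n #E≡n)
  heights : ∀ i → i < n → height τ i ≡ F i
  heights i i<n = trans (cong (λ es → nth es (suc i)) eh) (nth-applyUpTo n i i<n)

-- Bounce chains and bounce paths

Chain : (ℕ → ℕ) → ℕ → ℕ → List ℕ → ℕ → Set
Chain H n p []       q = p ≡ q
Chain H n p (c ∷ bs) q = p < n × p < c × H p ≡ c × Chain H n c bs q

chain-++ : ∀ {H n p q r} P {R} → Chain H n p P q → Chain H n q R r → Chain H n p (P ++ R) r
chain-++ []      refl                      chR = chR
chain-++ (c ∷ P) (p<n , p<c , Hp≡c , chP) chR = p<n , p<c , Hp≡c , chain-++ P chP chR

chain-≤ : ∀ {H n p q} bs → Chain H n p bs q → p ≤ q
chain-≤ []       refl                = ≤-refl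
chain-≤ (c ∷ bs) (_ , p<c , _ , ch) = ≤-trans (<⇒≤ p<c) (chain-≤ bs ch)

chain-transfer : ∀ {H H′ n p q} bs → Chain H n p bs q → (∀ i → p ≤ i → i < q → H′ i ≡ H i) →
                 Chain H′ n p bs q
chain-transfer []       ch                        _     = ch
chain-transfer (c ∷ bs) (p<n , p<c , Hp≡c , ch) agree =
  p<n , p<c , trans (agree _ ≤-refl (<-≤-trans p<c (chain-≤ bs ch))) Hp≡c ,
  chain-transfer bs ch (λ i c≤i i<q → agree i (≤-trans (<⇒≤ p<c) c≤i) i<q)

bouncePtsFrom-chain : ∀ f {hs n p} → suc ≤[ n ] (λ i → nth hs (suc i)) →
                      (∀ i → i < n → nth hs (suc i) ≤ n) → p ≤ n → n ≤ f + p → Chain (λ i → nth hs (suc i)) n p (bouncePtsFrom f hs n p) n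
bouncePtsFrom-chain zero                  _     _   p≤n n≤p = ≤-antisym p≤n n≤p
bouncePtsFrom-chain (suc f) {hs} {n} {p} above bnd p≤n n≤f+p with p <? n
... | no  p≮n = ≤-antisym p≤n (≮⇒≥ p≮n)
... | yes p<n = p<n , above p p<n , refl ,
  bouncePtsFrom-chain f above bnd (bnd p p<n)
    (≤-trans n≤f+p (≤-trans (≤-reflexive (sym (+-suc f p))) (+-monoʳ-≤ f (above p p<n))))

chain⇒bouncePtsFrom : ∀ f {hs n p} bs → Chain (λ i → nth hs (suc i)) n p bs n → n ≤ f + p →
                      bouncePtsFrom f hs n p ≡ bs
chain⇒bouncePtsFrom zero           []       refl                 _   = refl
chain⇒bouncePtsFrom (suc f) {p = p} []       refl                 _   with p <? p
... | yes p<p = contradiction p<p (<-irrefl refl)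
... | no  _   = refl
chain⇒bouncePtsFrom zero           (c ∷ bs) (p<n , _)            n≤p = contradiction p<n (≤⇒≯ n≤p)
chain⇒bouncePtsFrom (suc f) {n = n} {p} (c ∷ bs) (p<n , p<c , refl , ch) n≤f+p with p <? n
... | no  p≮n = contradiction p<n p≮n
... | yes _   = cong (c ∷_) (chain⇒bouncePtsFrom f bs ch
  (≤-trans n≤f+p (≤-trans (≤-reflexive (sym (+-suc f p))) (+-monoʳ-≤ f p<c))))

bouncePoints-chain : ∀ {n} π → IsHeights n (height π) → Chain (height π) n 0 (bouncePoints n π) n
bouncePoints-chain {n} π hπ =
  bouncePtsFrom-chain n (IsHeights.above-diagonal hπ) (IsHeights.bounded hπ) z≤n
    (≤-reflexive (sym (+-identityʳ n)))

chain⇒bouncePoints : ∀ {n} π bs → Chain (height π) n 0 bs n → bouncePoints n π ≡ bs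
chain⇒bouncePoints {n} π bs ch = chain⇒bouncePtsFrom n bs ch (≤-reflexive (sym (+-identityʳ n)))

Ascending : ℕ → ℕ → List ℕ → Set
Ascending n p []       = p ≡ n
Ascending n p (c ∷ bs) = p < c × Ascending n c bs

chain-ascending : ∀ {H n p q} bs → Chain H n p bs q → Ascending q p bs
chain-ascending []       refl               = refl
chain-ascending (c ∷ bs) (_ , p<c , _ , ch) = p<c , chain-ascending bs ch

ascending-≤ : ∀ {n p} bs → Ascending n p bs → p ≤ n
ascending-≤ []       refl        = ≤-refl
ascending-≤ (c ∷ bs) (p<c , asc) = ≤-trans (<⇒≤ p<c) (ascending-≤ bs asc)

bounceHeight : List ℕ → ℕ → ℕ
bounceHeight []       i = 0
bounceHeight (c ∷ bs) i with i <? c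
... | yes _ = c
... | no  _ = bounceHeight bs i

bounceHeight-< : ∀ {c} bs {i} → i < c → bounceHeight (c ∷ bs) i ≡ c
bounceHeight-< {c} bs {i} i<c with i <? c
... | yes _   = refl
... | no  i≮c = contradiction i<c i≮c

bounceHeight-≥ : ∀ {c} bs {i} → c ≤ i → bounceHeight (c ∷ bs) i ≡ bounceHeight bs i
bounceHeight-≥ {c} bs {i} c≤i with i <? c
... | yes i<c = contradiction c≤i (<⇒≱ i<c)
... | no  _   = refl

bounceHeight-++ : ∀ {H n q p} P {R i} → Chain H n q P p → p ≤ i →
                  bounceHeight (P ++ R) i ≡ bounceHeight R i
bounceHeight-++ []              refl             _   = refl
bounceHeight-++ (c ∷ P) {R} (_ , _ , _ , ch) p≤i =
  trans (bounceHeight-≥ (P ++ R) (≤-trans (chain-≤ P ch) p≤i)) (bounceHeight-++ P ch p≤i)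

bounceHeight-bounds : ∀ {n p} bs → Ascending n p bs →
                      ∀ i → p ≤ i → i < n → i < bounceHeight bs i × bounceHeight bs i ≤ n
bounceHeight-bounds []       refl        i p≤i i<n = contradiction i<n (≤⇒≯ p≤i)
bounceHeight-bounds (c ∷ bs) (p<c , asc) i p≤i i<n with i <? c
... | yes i<c = i<c , ascending-≤ bs asc
... | no  i≮c = bounceHeight-bounds bs asc i (≮⇒≥ i≮c) i<n

bounceHeight-monotone : ∀ {n p} bs → Ascending n p bs →
                        ∀ {i k} → p ≤ i → i ≤ k → k < n → bounceHeight bs i ≤ bounceHeight bs k
bounceHeight-monotone []       refl        p≤i i≤k k<n = ≤-refl
bounceHeight-monotone (c ∷ bs) (p<c , asc) {i} {k} p≤i i≤k k<n with i <? c | k <? c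
... | yes _   | yes _   = ≤-refl
... | yes _   | no  k≮c =
  <⇒≤ (≤-<-trans (≮⇒≥ k≮c) (proj₁ (bounceHeight-bounds bs asc k (≮⇒≥ k≮c) k<n)))
... | no  i≮c | yes k<c = contradiction (≤-<-trans i≤k k<c) i≮c
... | no  i≮c | no  _   = bounceHeight-monotone bs asc (≮⇒≥ i≮c) i≤k k<n

bounceHeight-isHeights : ∀ {n} bs → Ascending n 0 bs → IsHeights n (bounceHeight bs)
bounceHeight-isHeights bs asc = record
  { above-diagonal = λ i i<n → proj₁ (bounceHeight-bounds bs asc i z≤n i<n)
  ; bounded        = λ i i<n → proj₂ (bounceHeight-bounds bs asc i z≤n i<n)
  ; monotone       = bounceHeight-monotone bs asc z≤n
  }

bounceHeight-≤ : ∀ {H n p} bs → Monotone n H → Chain H n p bs n →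
                 ∀ i → p ≤ i → i < n → bounceHeight bs i ≤ H i
bounceHeight-≤ []                 _  refl                i p≤i i<n = contradiction i<n (≤⇒≯ p≤i)
bounceHeight-≤ {H} (c ∷ bs) mH (_ , _ , Hp≡c , ch) i p≤i i<n with i <? c
... | yes _   = subst (_≤ H i) Hp≡c (mH p≤i i<n)
... | no  i≮c = bounceHeight-≤ bs mH ch i (≮⇒≥ i≮c) i<n

chain-squeeze : ∀ {H H′ n p q} bs → Chain H n p bs q →
                (∀ i → p ≤ i → i < q → bounceHeight bs i ≤ H′ i × H′ i ≤ H i) → Chain H′ n p bs q
chain-squeeze []                 ch                        _  = ch
chain-squeeze {H} {H′} {p = p} (c ∷ bs) (p<n , p<c , Hp≡c , ch) sq =
  p<n , p<c , ≤-antisym (subst (H′ p ≤_) Hp≡c (proj₂ squeezed-p))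
                        (subst (_≤ H′ p) (bounceHeight-< bs p<c) (proj₁ squeezed-p)) ,
  chain-squeeze bs ch (λ i c≤i i<q → subst (λ h → h ≤ H′ i × H′ i ≤ H i) (bounceHeight-≥ bs c≤i)
                                           (sq i (≤-trans (<⇒≤ p<c) c≤i) i<q))
  where
  squeezed-p = sq p ≤-refl (<-≤-trans p<c (chain-≤ bs ch))

tri : ℕ → ℕ
tri zero    = 0
tri (suc k) = k + tri k

bounceArea : ℕ → List ℕ → ℕ
bounceArea p bs = sum (map tri (diffsFrom p bs))

bounceOf : ℕ → List ℕ → ℕ
bounceOf n bs = sum (map (n ∸_) bs)

bounceArea-++ : ∀ {H n p q} P {R} → Chain H n p P q →
                bounceArea p (P ++ R) ≡ bounceArea p P + bounceArea q R
bounceArea-++ []              refl             = refl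
bounceArea-++ {p = p} (c ∷ P) (_ , _ , _ , ch) =
  trans (cong (tri (c ∸ p) +_) (bounceArea-++ P ch)) (sym (+-assoc (tri (c ∸ p)) _ _))

bounceOf-++ : ∀ n P R → bounceOf n (P ++ R) ≡ bounceOf n P + bounceOf n R
bounceOf-++ n P R = trans (cong sum (map-++ (n ∸_) P R)) (sum-++ (map (n ∸_) P) _)

∑-tri : ∀ k → ∑ k (λ j → k ∸ suc j) ≡ tri k
∑-tri zero    = refl
∑-tri (suc k) = cong (k +_) (∑-tri k)

bounceHeight-area : ∀ {n p} bs → Ascending n p bs →
                    ∑ (n ∸ p) (λ j → bounceHeight bs (p + j) ∸ suc (p + j)) ≡ bounceArea p bs
bounceHeight-area {n} {p} []       refl        = cong (λ k → ∑ k (λ j → 0 ∸ suc (p + j))) (n∸n≡0 p)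
bounceHeight-area {n} {p} (c ∷ bs) (p<c , asc) = begin
  ∑ (n ∸ p) f
    ≡˘⟨ cong (λ k → ∑ k f) (trans (+-comm (c ∸ p) (n ∸ c)) (∸-telescope p≤c c≤n)) ⟩
  ∑ ((c ∸ p) + (n ∸ c)) f
    ≡⟨ ∑-split (c ∸ p) (n ∸ c) f ⟩
  ∑ (c ∸ p) f + ∑ (n ∸ c) (λ j → f ((c ∸ p) + j))
    ≡⟨ cong₂ _+_ (trans (∑-cong (c ∸ p) below-c) (∑-tri (c ∸ p)))
                 (trans (∑-cong (n ∸ c) from-c) (bounceHeight-area bs asc)) ⟩
  tri (c ∸ p) + bounceArea c bs
    ∎
  where
  open ≡-Reasoning
  p≤c = <⇒≤ p<c
  c≤n = ascending-≤ bs asc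
  f : ℕ → ℕ
  f j = bounceHeight (c ∷ bs) (p + j) ∸ suc (p + j)
  below-c : ∀ j → j < c ∸ p → f j ≡ (c ∸ p) ∸ suc j
  below-c j j<c∸p = begin
    bounceHeight (c ∷ bs) (p + j) ∸ suc (p + j) ≡⟨ cong (_∸ suc (p + j)) (bounceHeight-< bs p+j<c) ⟩
    c ∸ suc (p + j)                              ≡˘⟨ cong (c ∸_) (+-suc p j) ⟩
    c ∸ (p + suc j)                              ≡˘⟨ ∸-+-assoc c p (suc j) ⟩
    (c ∸ p) ∸ suc j                              ∎
    where
    p+j<c : p + j < c
    p+j<c = subst (p + j <_) (m+[n∸m]≡n p≤c) (+-monoʳ-< p j<c∸p)
  from-c : ∀ j → j < n ∸ c → f ((c ∸ p) + j) ≡ bounceHeight bs (c + j) ∸ suc (c + j)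
  from-c j _ = trans (cong (λ i → bounceHeight (c ∷ bs) i ∸ suc i) p+[c∸p+j]≡c+j)
                     (cong (_∸ suc (c + j)) (bounceHeight-≥ bs (m≤m+n c j)))
    where
    p+[c∸p+j]≡c+j : p + ((c ∸ p) + j) ≡ c + j
    p+[c∸p+j]≡c+j = trans (sym (+-assoc p (c ∸ p) j)) (cong (_+ j) (m+[n∸m]≡n p≤c))

eastHeights-E* : ∀ k y s → eastHeights y (replicate k E ++ s) ≡ replicate k y ++ eastHeights y s
eastHeights-E* zero    y s = refl
eastHeights-E* (suc k) y s = cong (y ∷_) (eastHeights-E* k y s)

areaFrom-++ : ∀ i xs ys → areaFrom i (xs ++ ys) ≡ areaFrom i xs + areaFrom (length xs + i) ys
areaFrom-++ i []       ys = refl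
areaFrom-++ i (x ∷ xs) ys =
  trans (cong ((x ∸ i) +_)
          (trans (areaFrom-++ (suc i) xs ys)
                 (cong (λ j → areaFrom (suc i) xs + areaFrom j ys) (+-suc (length xs) i))))
        (sym (+-assoc (x ∸ i) _ _))

areaFrom-replicate : ∀ a k → areaFrom (suc k) (replicate a (a + k)) ≡ tri a
areaFrom-replicate zero    k = refl
areaFrom-replicate (suc a) k = cong₂ _+_ (m+n∸n≡m a k)
  (trans (cong (λ h → areaFrom (suc (suc k)) (replicate a h)) (sym (+-suc a k)))
         (areaFrom-replicate a (suc k)))

areaFrom-bouncePath : ∀ k α → areaFrom (suc k) (eastHeights k (bouncePath α)) ≡ sum (map tri α)
areaFrom-bouncePath k []      = refl
areaFrom-bouncePath k (a ∷ α) = begin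
  areaFrom (suc k) (eastHeights k (replicate a N ++ replicate a E ++ bouncePath α))
    ≡⟨ cong (areaFrom (suc k)) (trans (eastHeights-N* a k _) (eastHeights-E* a (a + k) _)) ⟩
  areaFrom (suc k) (replicate a (a + k) ++ rest)
    ≡⟨ areaFrom-++ (suc k) (replicate a (a + k)) rest ⟩
  areaFrom (suc k) (replicate a (a + k)) + areaFrom (length (replicate a (a + k)) + suc k) rest
    ≡⟨ cong₂ _+_ (areaFrom-replicate a k)
                 (cong (λ i → areaFrom i rest) (trans (cong (_+ suc k) (length-replicate a)) (+-suc a k))) ⟩
  tri a + areaFrom (suc (a + k)) rest
    ≡⟨ cong (tri a +_) (areaFrom-bouncePath (a + k) α) ⟩
  tri a + sum (map tri α) ∎
  where
  open ≡-Reasoning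
  rest = eastHeights (a + k) (bouncePath α)

realize-bounce : ∀ {n F L} T → IsHeights n F → Chain F n 0 L n →
                 heightsArea n (bounceHeight L) ≤ T → T ≤ heightsArea n F →
                 ∃[ τ ] IsDyck n τ × area τ ≡ T × bouncePoints n τ ≡ L
realize-bounce {n} {F} {L} T hF chF lo hi
  with lower-area T (bounceHeight-isHeights L (chain-ascending L chF)) hF
                  (λ i → bounceHeight-≤ L (IsHeights.monotone hF) chF i z≤n) lo hi
... | F′ , hF′ , L≤F′ , F′≤F , areaF′≡T with realize hF′
...   | τ , dyckτ , heightτ≡F′ =
  τ , dyckτ ,
  trans (dyck-area {n} τ dyckτ) (trans (∑-cong n (λ i i<n → cong (_∸ suc i) (heightτ≡F′ i i<n))) areaF′≡T) ,
  chain⇒bouncePoints τ L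
    (chain-transfer L (chain-squeeze L chF (λ i _ i<n → L≤F′ i i<n , F′≤F i i<n))
                                          (λ i _ i<n → heightτ≡F′ i i<n))

-- Moving a bounce point up by one

bounceOf-raise : ∀ {n c} X → c < n → bounceOf n (c ∷ X) ≡ suc (bounceOf n (suc c ∷ X))
bounceOf-raise {n} X c<n = cong (_+ bounceOf n X) (sym (suc[m∸1+n]≡m∸n c<n))

bounceOf-merge : ∀ {n c} → suc c ≡ n → bounceOf n (c ∷ suc c ∷ []) ≡ suc (bounceOf n (suc c ∷ []))
bounceOf-merge {n} {c} sc≡n = trans (bounceOf-raise (suc c ∷ []) (subst (c <_) sc≡n ≤-refl))
  (cong (λ k → suc (k + bounceOf n (suc c ∷ []))) (trans (cong (n ∸_) sc≡n) (n∸n≡0 n)))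

bounceArea-raise : ∀ {p c c′} R → p ≤ c → c < c′ →
                   bounceArea p (suc c ∷ c′ ∷ R) + (c′ ∸ suc c) ≡ bounceArea p (c ∷ c′ ∷ R) + (c ∸ p)
bounceArea-raise {p} {c} {c′} R p≤c c<c′ = begin
  (tri (suc c ∸ p) + (tri v + T)) + v  ≡⟨ cong (λ k → (tri k + (tri v + T)) + v) (+-∸-assoc 1 p≤c) ⟩
  (tri (suc u) + (tri v + T)) + v      ≡⟨ shift u v (tri u) (tri v) T ⟩
  (tri u + (tri (suc v) + T)) + u      ≡⟨ cong (λ k → (tri u + (tri k + T)) + u) (suc[m∸1+n]≡m∸n c<c′) ⟩
  (tri u + (tri (c′ ∸ c) + T)) + u     ∎
  where
  open ≡-Reasoning
  u = c ∸ p
  v = c′ ∸ suc c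
  T = bounceArea c′ R
  shift : ∀ u v tu tv T → ((u + tu) + (tv + T)) + v ≡ (tu + ((v + tv) + T)) + u
  shift = solve-∀

bounceArea-merge : ∀ {p c} R → p ≤ c →
                   bounceArea p (suc c ∷ R) + (suc c ∸ suc c) ≡ bounceArea p (c ∷ suc c ∷ R) + (c ∸ p)
bounceArea-merge {p} {c} R p≤c = begin
  (tri (suc c ∸ p) + T) + (c ∸ c)      ≡⟨ cong₂ (λ k l → (tri k + T) + l) (+-∸-assoc 1 p≤c) (n∸n≡0 c) ⟩
  (tri (suc u) + T) + 0                ≡⟨ merge u (tri u) T ⟩
  (tri u + (tri 1 + T)) + u            ≡˘⟨ cong (λ k → (tri u + (tri k + T)) + u) (m+n∸n≡m 1 c) ⟩
  (tri u + (tri (suc c ∸ c) + T)) + u  ∎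
  where
  open ≡-Reasoning
  u = c ∸ p
  T = bounceArea (suc c) R
  merge : ∀ u tu T → ((u + tu) + T) + 0 ≡ (tu + (0 + T)) + u
  merge = solve-∀

raiseFrom : ℕ → ℕ → (ℕ → ℕ) → ℕ → ℕ
raiseFrom p v H i with i <? p
... | yes _ = H i
... | no  _ = H i ⊔ v

raiseFrom-< : ∀ {p v H i} → i < p → raiseFrom p v H i ≡ H i
raiseFrom-< {p} {i = i} i<p with i <? p
... | yes _   = refl
... | no  i≮p = contradiction i<p i≮p

raiseFrom-≥ : ∀ {p v H i} → p ≤ i → raiseFrom p v H i ≡ H i ⊔ v
raiseFrom-≥ {p} {i = i} p≤i with i <? p
... | yes i<p = contradiction p≤i (<⇒≱ i<p)
... | no  _   = refl

raiseFrom-≡ : ∀ {p v H i} → v ≤ H i → raiseFrom p v H i ≡ H i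
raiseFrom-≡ {p} {i = i} v≤Hi with i <? p
... | yes _ = refl
... | no  _ = m≥n⇒m⊔n≡m v≤Hi

raiseFrom-≥H : ∀ p v H i → H i ≤ raiseFrom p v H i
raiseFrom-≥H p v H i with i <? p
... | yes _ = ≤-refl
... | no  _ = m≤m⊔n (H i) v

raiseFrom-≤⊔ : ∀ p v H i → raiseFrom p v H i ≤ H i ⊔ v
raiseFrom-≤⊔ p v H i with i <? p
... | yes _ = m≤m⊔n (H i) v
... | no  _ = ≤-refl

raiseFrom-monotone : ∀ {n H} p v → Monotone n H → Monotone n (raiseFrom p v H)
raiseFrom-monotone {H = H} p v mH {i} {k} i≤k k<n with i <? p | k <? p
... | yes _   | yes _   = mH i≤k k<n
... | yes _   | no  _   = ≤-trans (mH i≤k k<n) (m≤m⊔n (H k) v)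
... | no  i≮p | yes k<p = contradiction (≤-<-trans i≤k k<p) i≮p
... | no  _   | no  _   = ⊔-monoˡ-≤ v (mH i≤k k<n)

raiseFrom-isHeights : ∀ {n H} p {v} → IsHeights n H → v ≤ n → IsHeights n (raiseFrom p v H)
raiseFrom-isHeights {H = H} p {v} hH v≤n = record
  { above-diagonal = λ i i<n → ≤-trans (above-diagonal i i<n) (raiseFrom-≥H p v H i)
  ; bounded        = λ i i<n → ≤-trans (raiseFrom-≤⊔ p v H i) (⊔-lub (bounded i i<n) v≤n)
  ; monotone       = raiseFrom-monotone p v monotone
  }
  where open IsHeights hH

module MinimalBounce {n : ℕ} {π : Path} (π∈ℬ : InB n π) where

  H : ℕ → ℕ
  H = height π

  heights : IsHeights n H
  heights = dyck-isHeights {n} π (proj₁ π∈ℬ)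

  open IsHeights heights

  L : List ℕ
  L = bouncePoints n π

  chain : Chain H n 0 L n
  chain = bouncePoints-chain π heights

  a A : ℕ
  a = area π
  A = area (bouncePath (bounceComp n π))

  A≡bounceArea : A ≡ bounceArea 0 L
  A≡bounceArea = areaFrom-bouncePath 0 (bounceComp n π)

  a≡heightsArea : a ≡ heightsArea n H
  a≡heightsArea = dyck-area {n} π (proj₁ π∈ℬ)

  A≡heightsArea : A ≡ heightsArea n (bounceHeight L)
  A≡heightsArea = trans A≡bounceArea (sym (bounceHeight-area L (chain-ascending L chain)))

  bounce-path-below : (λ i → bounceHeight L i ∸ suc i) ≤[ n ] (λ i → H i ∸ suc i)
  bounce-path-below i i<n = ∸-monoˡ-≤ (suc i) (bounceHeight-≤ L monotone chain i z≤n i<n)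

  A≤a : A ≤ a
  A≤a = subst₂ _≤_ (sym A≡heightsArea) (sym a≡heightsArea) (∑-mono-≤ n bounce-path-below)

  AreaGap : ℕ → ℕ → Set
  AreaGap x y = a + y + 1 ≤ A + x

  gap⇒> : ∀ {x y} → AreaGap x y → x > y
  gap⇒> {x} {y} gap = +-cancelˡ-≤ a (suc y) x (begin
    a + suc y   ≡˘⟨ trans (+-assoc a y 1) (cong (a +_) (+-comm y 1)) ⟩
    a + y + 1   ≤⟨ gap ⟩
    A + x       ≤⟨ +-monoˡ-≤ x A≤a ⟩
    a + x       ∎)
    where open ≤-Reasoning

  no-cheaper-bounce : ∀ {F L′} → IsHeights n F → Chain F n 0 L′ n →
                      heightsArea n (bounceHeight L′) ≤ suc a → suc a ≤ heightsArea n F →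
                      bounceOf n L ≡ suc (bounceOf n L′) → ⊥
  no-cheaper-bounce {L′ = L′} hF chF lo hi bounce≡ with realize-bounce (suc a) hF chF lo hi
  ... | τ , dyckτ , areaτ , bpτ = <-irrefl refl (subst (_≤ bounceOf n L′) bounce≡ minimal)
    where
    same-total : area τ + bounce n τ ≡ area π + bounce n π
    same-total = begin
      area τ + bounce n τ      ≡⟨ cong₂ _+_ areaτ (cong (bounceOf n) bpτ) ⟩
      suc a + bounceOf n L′    ≡˘⟨ +-suc a (bounceOf n L′) ⟩
      a + suc (bounceOf n L′)  ≡˘⟨ cong (a +_) bounce≡ ⟩
      a + bounceOf n L         ∎
      where open ≡-Reasoning
    minimal : bounceOf n L ≤ bounceOf n L′
    minimal = subst (bounceOf n L ≤_) (cong (bounceOf n) bpτ) (proj₂ π∈ℬ τ dyckτ same-total)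

  module Raise {P p c c′ R′} (eL : L ≡ P ++ c ∷ c′ ∷ R′) (chP : Chain H n 0 P p)
               (p<n : p < n) (p<c : p < c) (Hp≡c : H p ≡ c) (c<n : c < n) (c<c′ : c < c′)
               (no-gap : A + (c ∸ p) ≤ a + (c′ ∸ c)) where

    Hτ : ℕ → ℕ
    Hτ = raiseFrom p (suc c) H

    Hτ-at-p : Hτ p ≡ suc c
    Hτ-at-p = trans (raiseFrom-≥ {p} {suc c} {H} ≤-refl)
                 (trans (cong (_⊔ suc c) Hp≡c) (m≤n⇒m⊔n≡n (n≤1+n c)))

    area-raised : suc a ≤ heightsArea n Hτ
    area-raised = subst (_< heightsArea n Hτ) (sym a≡heightsArea)
      (∑-mono-< n (λ i _ → ∸-monoˡ-≤ (suc i) (raiseFrom-≥H p (suc c) H i)) p<n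
        (subst₂ (λ x y → x ∸ suc p < y ∸ suc p) (sym Hp≡c) (sym Hτ-at-p) (∸-monoˡ-< (n<1+n c) p<c)))

    raise-absurd : ∀ X → Chain Hτ n (suc c) X n →
                   bounceArea p (suc c ∷ X) + (c′ ∸ suc c) ≡ bounceArea p (c ∷ c′ ∷ R′) + (c ∸ p) →
                   bounceOf n (c ∷ c′ ∷ R′) ≡ suc (bounceOf n (suc c ∷ X)) → ⊥
    raise-absurd X chX area≡ bounce≡ =
      no-cheaper-bounce (raiseFrom-isHeights p heights c<n) chτ small area-raised bounceL≡
      where
      L′ = P ++ suc c ∷ X
      chτ : Chain Hτ n 0 L′ n
      chτ = chain-++ P (chain-transfer P chP (λ i _ i<p → raiseFrom-< i<p))
                       (p<n , m<n⇒m<1+n p<c , Hτ-at-p , chX)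
      T₀ = bounceArea 0 P
      Y  = bounceArea p (suc c ∷ X)
      Z  = bounceArea p (c ∷ c′ ∷ R′)
      u  = c ∸ p
      v  = c′ ∸ suc c
      small : heightsArea n (bounceHeight L′) ≤ suc a
      small = begin
        heightsArea n (bounceHeight L′) ≡⟨ bounceHeight-area L′ (chain-ascending L′ chτ) ⟩
        bounceArea 0 L′                 ≡⟨ bounceArea-++ P chP ⟩
        T₀ + Y                          ≤⟨ +-cancelʳ-≤ v (T₀ + Y) (suc a) (begin
          (T₀ + Y) + v   ≡⟨ +-assoc T₀ Y v ⟩
          T₀ + (Y + v)   ≡⟨ cong (T₀ +_) area≡ ⟩
          T₀ + (Z + u)   ≡˘⟨ +-assoc T₀ Z u ⟩
          (T₀ + Z) + u   ≡˘⟨ cong (_+ u) (trans A≡bounceArea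
                                                 (trans (cong (bounceArea 0) eL) (bounceArea-++ P chP))) ⟩
          A + u          ≤⟨ no-gap ⟩
          a + (c′ ∸ c)   ≡˘⟨ cong (a +_) (suc[m∸1+n]≡m∸n c<c′) ⟩
          a + suc v      ≡⟨ +-suc a v ⟩
          suc a + v      ∎) ⟩
        suc a                           ∎
        where open ≤-Reasoning
      bounceL≡ : bounceOf n L ≡ suc (bounceOf n L′)
      bounceL≡ = begin
        bounceOf n L                                         ≡⟨ cong (bounceOf n) eL ⟩
        bounceOf n (P ++ c ∷ c′ ∷ R′)                        ≡⟨ bounceOf-++ n P (c ∷ c′ ∷ R′) ⟩
        bounceOf n P + bounceOf n (c ∷ c′ ∷ R′)              ≡⟨ cong (bounceOf n P +_) bounce≡ ⟩
        bounceOf n P + suc (bounceOf n (suc c ∷ X))          ≡⟨ +-suc (bounceOf n P) _ ⟩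
        suc (bounceOf n P + bounceOf n (suc c ∷ X))          ≡˘⟨ cong suc (bounceOf-++ n P (suc c ∷ X)) ⟩
        suc (bounceOf n L′)                                  ∎
        where open ≡-Reasoning

  gap-by-contradiction : ∀ {x y} → (A + x ≤ a + y → ⊥) → AreaGap x y
  gap-by-contradiction {x} {y} no-gap-absurd with a + y + 1 ≤? A + x
  ... | yes gap = gap
  ... | no ¬gap =
    ⊥-elim (no-gap-absurd (≤-pred (subst (A + x <_) (+-comm (a + y) 1) (≰⇒> ¬gap))))

  step-absurd : ∀ {P p c c′ R′} → L ≡ P ++ c ∷ c′ ∷ R′ → Chain H n 0 P p →
                Chain H n p (c ∷ c′ ∷ R′) n → A + (c ∸ p) ≤ a + (c′ ∸ c) → suc c < c′ → H (suc c) ≡ c′ → ⊥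
  step-absurd {p = p} {c} {c′} {R′} eL chP (p<n , p<c , Hp≡c , c<n , c<c′ , Hc≡c′ , chR)
    no-gap sc<c′ Hsc≡c′ =
    raise-absurd (c′ ∷ R′) chX (bounceArea-raise R′ (<⇒≤ p<c) c<c′) (bounceOf-raise (c′ ∷ R′) c<n)
    where
    open Raise eL chP p<n p<c Hp≡c c<n c<c′ no-gap
    c′≤n : c′ ≤ n
    c′≤n = chain-≤ R′ chR
    raised-beyond-c : ∀ i → c ≤ i → i < n → Hτ i ≡ H i
    raised-beyond-c i c≤i i<n =
      raiseFrom-≡ {p} {suc c} {H} (≤-trans c<c′ (subst (_≤ H i) Hc≡c′ (monotone c≤i i<n)))
    sc<n : suc c < n
    sc<n = <-≤-trans sc<c′ c′≤n
    chX : Chain Hτ n (suc c) (c′ ∷ R′) n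
    chX = sc<n , sc<c′ , trans (raised-beyond-c (suc c) (n≤1+n c) sc<n) Hsc≡c′ ,
          chain-transfer R′ chR (λ i c′≤i i<n → raised-beyond-c i (≤-trans (<⇒≤ c<c′) c′≤i) i<n)

  merge-absurd : ∀ {P p c} → L ≡ P ++ c ∷ suc c ∷ [] → Chain H n 0 P p →
                 Chain H n p (c ∷ suc c ∷ []) n → A + (c ∸ p) ≤ a + (suc c ∸ c) → ⊥
  merge-absurd eL chP (p<n , p<c , Hp≡c , c<n , c<sc , _ , sc≡n) no-gap =
    raise-absurd [] sc≡n (bounceArea-merge [] (<⇒≤ p<c)) (bounceOf-merge sc≡n)
    where open Raise eL chP p<n p<c Hp≡c c<n c<sc no-gap

  area-surplus : ∀ {P p c c′ R′} → L ≡ P ++ c ∷ c′ ∷ R′ → Chain H n 0 P p → p < c → c′ ≤ n →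
                 (∀ i → suc c ≤ i → i < c′ → c′ < H i) → A + (c′ ∸ suc c) ≤ a
  area-surplus {P} {c = c} {c′} {R′} eL chP p<c c′≤n above-c′ =
    subst₂ (λ x y → x + (c′ ∸ suc c) ≤ y) (sym A≡heightsArea) (sym a≡heightsArea)
      (∑-mono-gap n (suc c) c′ bounce-path-below gap c′≤n)
    where
    gap : ∀ {i} → suc c ≤ i → i < c′ → bounceHeight L i ∸ suc i < H i ∸ suc i
    gap {i} sc≤i i<c′ =
      subst (λ h → h ∸ suc i < H i ∸ suc i) (sym L-at-i) (∸-monoˡ-< (above-c′ i sc≤i i<c′) i<c′)
      where
      c≤i = ≤-trans (n≤1+n c) sc≤i
      L-at-i : bounceHeight L i ≡ c′
      L-at-i = begin
        bounceHeight L i                   ≡⟨ cong (λ bs → bounceHeight bs i) eL ⟩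
        bounceHeight (P ++ c ∷ c′ ∷ R′) i ≡⟨ bounceHeight-++ P chP (≤-trans (<⇒≤ p<c) c≤i) ⟩
        bounceHeight (c ∷ c′ ∷ R′) i      ≡⟨ bounceHeight-≥ (c′ ∷ R′) c≤i ⟩
        bounceHeight (c′ ∷ R′) i          ≡⟨ bounceHeight-< R′ i<c′ ⟩
        c′                                 ∎
        where open ≡-Reasoning

  next-gap-absurd : ∀ {c c′ c″} → c < c′ → c′ < c″ → A + (c′ ∸ suc c) ≤ a →
                    AreaGap (c′ ∸ c) (c″ ∸ c′) → ⊥
  next-gap-absurd {c} {c′} {c″} c<c′ c′<c″ surplus gap = <-irrefl refl (begin
    suc (a + 1)            ≡⟨ +-comm 1 (a + 1) ⟩
    a + 1 + 1              ≤⟨ +-monoˡ-≤ 1 (+-monoʳ-≤ a (m<n⇒0<n∸m c′<c″)) ⟩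
    a + (c″ ∸ c′) + 1      ≤⟨ gap ⟩
    A + (c′ ∸ c)           ≡˘⟨ cong (A +_) (suc[m∸1+n]≡m∸n c<c′) ⟩
    A + suc (c′ ∸ suc c)   ≡⟨ +-suc A _ ⟩
    suc (A + (c′ ∸ suc c)) ≤⟨ s≤s surplus ⟩
    suc a                  ≡⟨ +-comm 1 a ⟩
    a + 1                  ∎)
    where open ≤-Reasoning

  step-or-surplus : ∀ {c c′} → c < c′ → H c ≡ c′ → c′ ≤ n →
                    (suc c < c′ × H (suc c) ≡ c′) ⊎ (∀ i → suc c ≤ i → i < c′ → c′ < H i)
  step-or-surplus {c} {c′} c<c′ Hc≡c′ c′≤n with m≤n⇒m<n∨m≡n c<c′
  ... | inj₂ refl   = inj₂ (λ i sc≤i i<sc → contradiction i<sc (≤⇒≯ sc≤i))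
  ... | inj₁ sc<c′
    with m≤n⇒m<n∨m≡n (subst (_≤ H (suc c)) Hc≡c′ (monotone (n≤1+n c) (<-≤-trans sc<c′ c′≤n)))
  ...   | inj₂ c′≡Hsc = inj₁ (sc<c′ , sym c′≡Hsc)
  ...   | inj₁ c′<Hsc = inj₂ (λ i sc≤i i<c′ → <-≤-trans c′<Hsc (monotone sc≤i (<-≤-trans i<c′ c′≤n)))

  last-pair-absurd : ∀ {P p c c′} → L ≡ P ++ c ∷ c′ ∷ [] → Chain H n 0 P p →
                     Chain H n p (c ∷ c′ ∷ []) n → A + (c ∸ p) ≤ a + (c′ ∸ c) → ⊥
  last-pair-absurd eL chP ch@(_ , _ , _ , _ , c<c′ , Hc≡c′ , c′≡n) no-gap with m≤n⇒m<n∨m≡n c<c′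
  ... | inj₂ refl   = merge-absurd eL chP ch no-gap
  ... | inj₁ sc<c′ with step-or-surplus c<c′ Hc≡c′ (≤-reflexive c′≡n)
  ...   | inj₁ (_ , Hsc≡c′) = step-absurd eL chP ch no-gap sc<c′ Hsc≡c′
  ...   | inj₂ surplus      = contradiction (bounded _ (subst (_ <_) c′≡n sc<c′))
                                            (<⇒≱ (subst (_< _) c′≡n (surplus _ ≤-refl sc<c′)))

  inner-pair-absurd : ∀ {P p c c′ c″ R″} → L ≡ P ++ c ∷ c′ ∷ c″ ∷ R″ → Chain H n 0 P p →
                      Chain H n p (c ∷ c′ ∷ c″ ∷ R″) n → AreaGap (c′ ∸ c) (c″ ∸ c′) →
                      A + (c ∸ p) ≤ a + (c′ ∸ c) → ⊥
  inner-pair-absurd eL chP ch@(_ , p<c , _ , _ , c<c′ , Hc≡c′ , c′<n , c′<c″ , _) next-gap no-gap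
    with step-or-surplus c<c′ Hc≡c′ (<⇒≤ c′<n)
  ... | inj₁ (sc<c′ , Hsc≡c′) = step-absurd eL chP ch no-gap sc<c′ Hsc≡c′
  ... | inj₂ surplus          =
    next-gap-absurd c<c′ c′<c″ (area-surplus eL chP p<c (<⇒≤ c′<n) surplus) next-gap

  cons-gap : ∀ {P p c c′ c″ R} → L ≡ P ++ c ∷ c′ ∷ c″ ∷ R → Chain H n 0 P p →
             Chain H n p (c ∷ c′ ∷ c″ ∷ R) n →
             Linked AreaGap (diffsFrom c (c′ ∷ c″ ∷ R)) → Linked AreaGap (diffsFrom p (c ∷ c′ ∷ c″ ∷ R))
  cons-gap eL chP ch gaps =
    gap-by-contradiction (inner-pair-absurd eL chP ch (Linked.head gaps)) ∷ gaps

  gaps-from : ∀ {P p} R → L ≡ P ++ R → Chain H n 0 P p → Chain H n p R n →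
              Linked AreaGap (diffsFrom p R)
  gaps-from []                      _  _   _  = []
  gaps-from (c ∷ [])                _  _   _  = [-]
  gaps-from (c ∷ c′ ∷ [])           eL chP ch = gap-by-contradiction (last-pair-absurd eL chP ch) ∷ [-]
  gaps-from {P} (c ∷ R@(_ ∷ _ ∷ _)) eL chP ch@(p<n , p<c , Hp≡c , chR) =
    cons-gap eL chP ch (gaps-from R (trans eL (sym (++-assoc P (c ∷ []) R)))
                                    (chain-++ P chP (p<n , p<c , Hp≡c , refl)) chR)

  bounce-gaps : Linked AreaGap (bounceComp n π)
  bounce-gaps = gaps-from L refl refl chain

lemma4p10 : (n : ℕ) (π : Path) → InB n π →
    Linked _>_ (bounceComp n π)
      × Linked (λ x y → area π + y + 1 ≤ area (bouncePath (bounceComp n π)) + x)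
          (bounceComp n π)
lemma4p10 n π π∈ℬ = Linked.map gap⇒> bounce-gaps , bounce-gaps
  where open MinimalBounce {n} {π} π∈ℬ
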